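{- For every poset $P$, $\operatorname{iir}(P)\leq|P|$.
   Context: All posets are finite with non-empty ground sets. Given a poset $P$, a family $\mathcal{S}=\{S_x:x\in P\}$ of sets is an inclusion representation of $P$ if for all $x,y\in P$, $x\le y$ in $P$ if and only if $S_x\subseteq S_y$; $\bigcup\mathcal{S}$ is its ground set. For inclusion representations $\mathcal{S}=\{S_x\}$ and $\mathcal{S}'=\{S'_x\}$ of $P$, $\mathcal{S}$ is a reduction of $\mathcal{S}'$ if $|\bigcup\mathcal{S}|\le|\bigcup\mathcal{S}'|$ and $|S_x|\le|S'_x|$ for every $x\in P$; they are equivalent if each is a reduction of the other; $\mathcal{S}$ is a strict reduction of $\mathcal{S}'$ if it is a reduction but they are not equivalent. An inclusion representation with no strict reduction is irreducible. $\operatorname{iir}(P)$ denotes the maximum non-negative integer $w$ such that $P$ has an irreducible inclusion representation whose ground set has size $w$. -}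

module Defs where

open import Level using (0ℓ)
open import Data.Nat using (ℕ; _≤_)
open import Data.Fin using (Fin)
open import Data.Fin.Subset using (Subset; _⊆_; ⋃; ∣_∣)
open import Data.List using (tabulate)
open import Data.Product using (_×_; Σ)
open import Relation.Nullary using (¬_)
open import Relation.Binary.PropositionalEquality using (_≡_)
open import Relation.Binary.Structures using (IsPartialOrder)

record FinPoset : Set₁ where
  field
    size      : ℕ
    _≤P_      : Fin size → Fin size → Set
    isPartial : IsPartialOrder _≡_ _≤P_
open FinPoset public

-- An inclusion representation of P. Since all sets involved are finite,
-- the sets are taken (w.l.o.g., up to relabelling) as subsets of Fin m
-- for some m; the ground set is the union of the family (not Fin m).
record InclRep (P : FinPoset) : Set where
  field
    m       : ℕ
    S       : Fin (size P) → Subset m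
    represents : ∀ x y → ((_≤P_ P x y → S x ⊆ S y) × (S x ⊆ S y → _≤P_ P x y))
open InclRep public

groundSize : {P : FinPoset} → InclRep P → ℕ
groundSize {P} R = ∣ ⋃ (tabulate (S R)) ∣

IsReduction : {P : FinPoset} → InclRep P → InclRep P → Set
IsReduction {P} R R' =
  (groundSize R ≤ groundSize R') × (∀ (x : Fin (size P)) → ∣ S R x ∣ ≤ ∣ S R' x ∣)

Equivalent : {P : FinPoset} → InclRep P → InclRep P → Set
Equivalent R R' = IsReduction R R' × IsReduction R' R

IsStrictReduction : {P : FinPoset} → InclRep P → InclRep P → Set
IsStrictReduction R R' = IsReduction R R' × ¬ Equivalent R R'

Irreducible : {P : FinPoset} → InclRep P → Set
Irreducible {P} R = ∀ (R' : InclRep P) → ¬ IsStrictReduction R' R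

{-# OPTIONS --safe #-}
module Submission where

-- Suppose an inclusion representation 𝒮 of P has a ground set U with more than
-- |P| points. Call u ∈ S x fresh at x if u lies in no S z ⊂ S x; every u ∈ S x
-- is fresh at some z with S z ⊆ S x. For V ⊆ U, the owners of V are the x at
-- which some point of V is fresh. Replacing the points of V by one new point per
-- owner, S′ x = (owners V ∩ ↓x) ⊔ (S x ∖ V), preserves and reflects inclusions,
-- since a point of V ∩ S x is recovered through an owner below x. If V has more
-- points than owners the ground set shrinks, and if moreover
-- |owners V ∩ ↓x| ≤ |S x ∩ V| for all x no set grows: a strict reduction. Such a
-- V exists by descent: V = U has at most |P| owners, and while some x violates
-- the balance condition, V ∖ S x keeps a surplus of points and has fewer owners.

open import Defs
open import Data.Nat using (ℕ; _≤_; _<_; _+_; suc; z≤n; _<?_)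
open import Data.Nat.Induction using (<-wellFounded)
open import Data.Nat.Properties
  using (≤-<-trans; +-suc; +-monoˡ-≤; +-monoˡ-<; +-cancelˡ-<; m<n+m; <⇒≤; <⇒≱; ≮⇒≥; module ≤-Reasoning)
open import Data.Fin using (Fin; zero; suc; _↑ˡ_; _↑ʳ_)
open import Data.Fin.Properties using (any?; all?)
open import Data.Fin.Subset
open import Data.Fin.Subset.Properties
open import Data.List using (_∷_; tabulate)
open import Data.List.Membership.Propositional using () renaming (_∈_ to _∈ₗ_)
open import Data.List.Membership.Propositional.Properties using (∈-tabulate⁺)
open import Data.List.Relation.Unary.All using (All; []; _∷_)
open import Data.List.Relation.Unary.All.Properties using (tabulate⁺)
import Data.List.Relation.Unary.Any as Any
open import Data.Vec using (_∷_; []; _++_; here; there)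
import Data.Vec as Vec
open import Data.Vec.Properties using (lookup∘tabulate; []=⇒lookup; lookup⇒[]=)
open import Data.Product using (_×_; _,_; proj₁; proj₂; ∃-syntax)
open import Data.Sum using ([_,_]′)
open import Data.Empty using (⊥-elim)
open import Function using (_∘_)
open import Induction.WellFounded using (Acc; acc)
open import Level using (Level)
open import Relation.Nullary using (Dec; does; yes; no; ¬?)
open import Relation.Nullary.Decidable using (_×-dec_; _→-dec_; dec-true)
open import Relation.Unary using (Pred; Decidable)
open import Relation.Binary.PropositionalEquality using (_≡_; refl; sym; trans; cong)

private variable
  ℓ : Level
  k l n : ℕ

select : {Q : Pred (Fin n) ℓ} → Decidable Q → Subset n
select Q? = Vec.tabulate (does ∘ Q?)

module _ {Q : Pred (Fin n) ℓ} (Q? : Decidable Q) {i : Fin n} where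

  ∈-select⁺ : Q i → i ∈ select Q?
  ∈-select⁺ q = lookup⇒[]= i _ (trans (lookup∘tabulate (does ∘ Q?) i) (dec-true (Q? i) q))

  ∈-select⁻ : i ∈ select Q? → Q i
  ∈-select⁻ i∈ with Q? i | trans (sym (lookup∘tabulate (does ∘ Q?) i)) ([]=⇒lookup i∈)
  ... | yes q | _ = q
  ... | no _  | ()

x∈p─q⁻ : ∀ {x : Fin n} (p q : Subset n) → x ∈ p ─ q → x ∈ p × x ∉ q
x∈p─q⁻            (inside ∷ p)  (outside ∷ q) here       = here , λ ()
x∈p─q⁻ {x = zero} (outside ∷ p) (inside ∷ q)  ()
x∈p─q⁻ {x = zero} (outside ∷ p) (outside ∷ q) ()
x∈p─q⁻            (_ ∷ p)       (_ ∷ q)       (there x∈) with x∈p─q⁻ p q x∈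
... | x∈p , x∉q = there x∈p , x∉q ∘ drop-there

∣p∣≡∣p∩q∣+∣p─q∣ : ∀ (p q : Subset n) → ∣ p ∣ ≡ ∣ p ∩ q ∣ + ∣ p ─ q ∣
∣p∣≡∣p∩q∣+∣p─q∣ []            []            = refl
∣p∣≡∣p∩q∣+∣p─q∣ (outside ∷ p) (inside ∷ q)  = ∣p∣≡∣p∩q∣+∣p─q∣ p q
∣p∣≡∣p∩q∣+∣p─q∣ (outside ∷ p) (outside ∷ q) = ∣p∣≡∣p∩q∣+∣p─q∣ p q
∣p∣≡∣p∩q∣+∣p─q∣ (inside ∷ p)  (inside ∷ q)  = cong suc (∣p∣≡∣p∩q∣+∣p─q∣ p q)
∣p∣≡∣p∩q∣+∣p─q∣ (inside ∷ p)  (outside ∷ q) =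
  trans (cong suc (∣p∣≡∣p∩q∣+∣p─q∣ p q)) (sym (+-suc ∣ p ∩ q ∣ ∣ p ─ q ∣))

∣p++q∣≡∣p∣+∣q∣ : ∀ (p : Subset k) (q : Subset l) → ∣ p ++ q ∣ ≡ ∣ p ∣ + ∣ q ∣
∣p++q∣≡∣p∣+∣q∣ []            q = refl
∣p++q∣≡∣p∣+∣q∣ (inside ∷ p)  q = cong suc (∣p++q∣≡∣p∣+∣q∣ p q)
∣p++q∣≡∣p∣+∣q∣ (outside ∷ p) q = ∣p++q∣≡∣p∣+∣q∣ p q

x∈p⇒x↑ˡ∈p++q : ∀ (p : Subset k) (q : Subset l) {x} → x ∈ p → x ↑ˡ l ∈ p ++ q
x∈p⇒x↑ˡ∈p++q (_ ∷ p) q here       = here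
x∈p⇒x↑ˡ∈p++q (_ ∷ p) q (there x∈) = there (x∈p⇒x↑ˡ∈p++q p q x∈)

x↑ˡ∈p++q⇒x∈p : ∀ (p : Subset k) (q : Subset l) {x} → x ↑ˡ l ∈ p ++ q → x ∈ p
x↑ˡ∈p++q⇒x∈p (_ ∷ p) q {zero}  here       = here
x↑ˡ∈p++q⇒x∈p (_ ∷ p) q {suc x} (there x∈) = there (x↑ˡ∈p++q⇒x∈p p q x∈)

x∈q⇒k↑ʳx∈p++q : ∀ (p : Subset k) (q : Subset l) {x} → x ∈ q → k ↑ʳ x ∈ p ++ q
x∈q⇒k↑ʳx∈p++q []      q x∈ = x∈
x∈q⇒k↑ʳx∈p++q (_ ∷ p) q x∈ = there (x∈q⇒k↑ʳx∈p++q p q x∈)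

k↑ʳx∈p++q⇒x∈q : ∀ (p : Subset k) (q : Subset l) {x} → k ↑ʳ x ∈ p ++ q → x ∈ q
k↑ʳx∈p++q⇒x∈q []      q x∈         = x∈
k↑ʳx∈p++q⇒x∈q (_ ∷ p) q (there x∈) = k↑ʳx∈p++q⇒x∈q p q x∈

⊆-++⁺ : ∀ {p p′ : Subset k} {q q′ : Subset l} → p ⊆ p′ → q ⊆ q′ → p ++ q ⊆ p′ ++ q′
⊆-++⁺ {p = []}    {[]}    _    q⊆q′ x∈ = q⊆q′ x∈
⊆-++⁺ {p = _ ∷ _} {_ ∷ _} p⊆p′ _    {zero} here with p⊆p′ here
... | here = here
⊆-++⁺ {p = _ ∷ _} {_ ∷ _} p⊆p′ q⊆q′ {suc _} (there x∈) = there (⊆-++⁺ (drop-∷-⊆ p⊆p′) q⊆q′ x∈)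

⊆-++⁻ˡ : ∀ {p p′ : Subset k} {q q′ : Subset l} → p ++ q ⊆ p′ ++ q′ → p ⊆ p′
⊆-++⁻ˡ {p = p} {p′} {q} {q′} ⊆′ = x↑ˡ∈p++q⇒x∈p p′ q′ ∘ ⊆′ ∘ x∈p⇒x↑ˡ∈p++q p q

⊆-++⁻ʳ : ∀ {p p′ : Subset k} {q q′ : Subset l} → p ++ q ⊆ p′ ++ q′ → q ⊆ q′
⊆-++⁻ʳ {p = p} {p′} {q} {q′} ⊆′ = k↑ʳx∈p++q⇒x∈q p′ q′ ∘ ⊆′ ∘ x∈q⇒k↑ʳx∈p++q p q

∩-monoʳ-⊆ : ∀ (p : Subset n) {q q′} → q ⊆ q′ → p ∩ q ⊆ p ∩ q′
∩-monoʳ-⊆ p {q} q⊆q′ x∈ with x∈p∩q⁻ p q x∈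
... | x∈p , x∈q = x∈p∩q⁺ (x∈p , q⊆q′ x∈q)

─-monoˡ-⊆ : ∀ {p p′ : Subset n} (q : Subset n) → p ⊆ p′ → p ─ q ⊆ p′ ─ q
─-monoˡ-⊆ {p = p} q p⊆p′ x∈ with x∈p─q⁻ p q x∈
... | x∈p , x∉q = x∈p∧x∉q⇒x∈p─q (p⊆p′ x∈p) x∉q

p∈ps⇒p⊆⋃ps : ∀ {p : Subset n} {ps} → p ∈ₗ ps → p ⊆ ⋃ ps
p∈ps⇒p⊆⋃ps {ps = _ ∷ ps} (Any.here refl) = p⊆p∪q (⋃ ps)
p∈ps⇒p⊆⋃ps {ps = p ∷ _}  (Any.there p∈)  = q⊆p∪q p _ ∘ p∈ps⇒p⊆⋃ps p∈

⋃-least : ∀ {q : Subset n} {ps} → All (_⊆ q) ps → ⋃ ps ⊆ q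
⋃-least                []           x∈ = ⊥-elim (∉⊥ x∈)
⋃-least {ps = p ∷ ps} (p⊆q ∷ ps⊆q) x∈ = [ p⊆q , ⋃-least ps⊆q ]′ (x∈p∪q⁻ p (⋃ ps) x∈)

module Compression (𝒮 : Fin n → Subset k) where

  U : Subset k
  U = ⋃ (tabulate 𝒮)

  𝒮⊆U : ∀ x → 𝒮 x ⊆ U
  𝒮⊆U x = p∈ps⇒p⊆⋃ps (∈-tabulate⁺ x)

  fresh? : ∀ x u → Dec (u ∈ 𝒮 x × ∀ z → 𝒮 z ⊂ 𝒮 x → u ∉ 𝒮 z)
  fresh? x u = u ∈? 𝒮 x ×-dec all? λ z → 𝒮 z ⊂? 𝒮 x →-dec ¬? (u ∈? 𝒮 z)

  Fresh : Fin n → Subset k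
  Fresh x = select (fresh? x)

  Fresh⊆𝒮 : ∀ {x} → Fresh x ⊆ 𝒮 x
  Fresh⊆𝒮 {x} u∈ = proj₁ (∈-select⁻ (fresh? x) u∈)

  fresh-below′ : ∀ {u} x → Acc _<_ ∣ 𝒮 x ∣ → u ∈ 𝒮 x → ∃[ z ] 𝒮 z ⊆ 𝒮 x × u ∈ Fresh z
  fresh-below′ {u} x (acc rec) u∈x with any? (λ z → 𝒮 z ⊂? 𝒮 x ×-dec u ∈? 𝒮 z)
  ... | yes (z , z⊂x , u∈z) =
    let w , w⊆z , u∈Fw = fresh-below′ z (rec (p⊂q⇒∣p∣<∣q∣ z⊂x)) u∈z
    in w , ⊆-trans w⊆z (p⊂q⇒p⊆q z⊂x) , u∈Fw
  ... | no none =
    x , ⊆-refl , ∈-select⁺ (fresh? x) (u∈x , λ z z⊂x u∈z → none (z , z⊂x , u∈z))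

  fresh-below : ∀ {u x} → u ∈ 𝒮 x → ∃[ z ] 𝒮 z ⊆ 𝒮 x × u ∈ Fresh z
  fresh-below {x = x} = fresh-below′ x (<-wellFounded _)

  owns? : ∀ V x → Dec (Nonempty (Fresh x ∩ V))
  owns? V x = nonempty? (Fresh x ∩ V)

  owners : Subset k → Subset n
  owners V = select (owns? V)

  owner⁺ : ∀ {u x V} → u ∈ Fresh x → u ∈ V → x ∈ owners V
  owner⁺ {V = V} u∈F u∈V = ∈-select⁺ (owns? V) (_ , x∈p∩q⁺ (u∈F , u∈V))

  owner⁻ : ∀ {x V} → x ∈ owners V → ∃[ u ] u ∈ Fresh x × u ∈ V
  owner⁻ {x} {V} x∈ with ∈-select⁻ (owns? V) x∈
  ... | u , u∈ = u , x∈p∩q⁻ (Fresh x) V u∈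

  below? : ∀ x z → Dec (𝒮 z ⊆ 𝒮 x)
  below? x z = 𝒮 z ⊆? 𝒮 x

  below : Fin n → Subset n
  below x = select (below? x)

  below-mono : ∀ {x y} → 𝒮 x ⊆ 𝒮 y → below x ⊆ below y
  below-mono {x} {y} x⊆y z∈ = ∈-select⁺ (below? y) (⊆-trans (∈-select⁻ (below? x) z∈) x⊆y)

  -- The first n points of the new ground set are labels for the owners of V.
  squeeze : Subset k → Fin n → Subset (n + k)
  squeeze V x = (owners V ∩ below x) ++ (𝒮 x ─ V)

  squeeze-mono : ∀ V {x y} → 𝒮 x ⊆ 𝒮 y → squeeze V x ⊆ squeeze V y
  squeeze-mono V x⊆y = ⊆-++⁺ (∩-monoʳ-⊆ (owners V) (below-mono x⊆y)) (─-monoˡ-⊆ V x⊆y)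

  squeeze-reflects : ∀ V {x y} → squeeze V x ⊆ squeeze V y → 𝒮 x ⊆ 𝒮 y
  squeeze-reflects V {x} {y} sx⊆sy {u} u∈x with u ∈? V
  ... | no u∉V = proj₁ (x∈p─q⁻ (𝒮 y) V (⊆-++⁻ʳ sx⊆sy (x∈p∧x∉q⇒x∈p─q u∈x u∉V)))
  ... | yes u∈V =
    let z , z⊆x , u∈Fz = fresh-below u∈x
        z∈↓y = proj₂ (x∈p∩q⁻ (owners V) (below y)
                 (⊆-++⁻ˡ sx⊆sy (x∈p∩q⁺ (owner⁺ u∈Fz u∈V , ∈-select⁺ (below? x) z⊆x))))
    in ∈-select⁻ (below? y) z∈↓y (Fresh⊆𝒮 u∈Fz)

  Balanced : Subset k → Set
  Balanced V = ∀ x → ∣ owners V ∩ below x ∣ ≤ ∣ 𝒮 x ∩ V ∣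

  Surplus : Subset k → Set
  Surplus V = V ⊆ U × ∣ owners V ∣ < ∣ V ∣

  squeeze-size : ∀ {V} → Balanced V → ∀ x → ∣ squeeze V x ∣ ≤ ∣ 𝒮 x ∣
  squeeze-size {V} balanced x = begin
    ∣ squeeze V x ∣                        ≡⟨ ∣p++q∣≡∣p∣+∣q∣ (owners V ∩ below x) (𝒮 x ─ V) ⟩
    ∣ owners V ∩ below x ∣ + ∣ 𝒮 x ─ V ∣   ≤⟨ +-monoˡ-≤ ∣ 𝒮 x ─ V ∣ (balanced x) ⟩
    ∣ 𝒮 x ∩ V ∣ + ∣ 𝒮 x ─ V ∣              ≡⟨ sym (∣p∣≡∣p∩q∣+∣p─q∣ (𝒮 x) V) ⟩
    ∣ 𝒮 x ∣                                ∎
    where open ≤-Reasoning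

  squeeze-ground : ∀ {V} → Surplus V → ∣ ⋃ (tabulate (squeeze V)) ∣ < ∣ U ∣
  squeeze-ground {V} (V⊆U , surplus) = begin-strict
    ∣ ⋃ (tabulate (squeeze V)) ∣  ≤⟨ p⊆q⇒∣p∣≤∣q∣ (⋃-least (tabulate⁺ squeeze⊆)) ⟩
    ∣ owners V ++ (U ─ V) ∣       ≡⟨ ∣p++q∣≡∣p∣+∣q∣ (owners V) (U ─ V) ⟩
    ∣ owners V ∣ + ∣ U ─ V ∣      <⟨ +-monoˡ-< ∣ U ─ V ∣ surplus ⟩
    ∣ V ∣ + ∣ U ─ V ∣             ≤⟨ +-monoˡ-≤ ∣ U ─ V ∣ (p⊆q⇒∣p∣≤∣q∣ λ u∈V → x∈p∩q⁺ (V⊆U u∈V , u∈V)) ⟩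
    ∣ U ∩ V ∣ + ∣ U ─ V ∣         ≡⟨ sym (∣p∣≡∣p∩q∣+∣p─q∣ U V) ⟩
    ∣ U ∣                         ∎
    where
    open ≤-Reasoning
    squeeze⊆ : ∀ x → squeeze V x ⊆ owners V ++ (U ─ V)
    squeeze⊆ x = ⊆-++⁺ (p∩q⊆p (owners V) (below x)) (─-monoˡ-⊆ V (𝒮⊆U x))

  owners-─ : ∀ V x → owners (V ─ 𝒮 x) ⊆ owners V ─ below x
  owners-─ V x {z} z∈ with owner⁻ z∈
  ... | u , u∈Fz , u∈V─x with x∈p─q⁻ V (𝒮 x) u∈V─x
  ...   | u∈V , u∉x = x∈p∧x∉q⇒x∈p─q (owner⁺ u∈Fz u∈V)
                        (λ z∈↓x → u∉x (∈-select⁻ (below? x) z∈↓x (Fresh⊆𝒮 u∈Fz)))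

  surplus-─ : ∀ {V} x → Surplus V → ∣ 𝒮 x ∩ V ∣ < ∣ owners V ∩ below x ∣ →
              Surplus (V ─ 𝒮 x) × ∣ owners (V ─ 𝒮 x) ∣ < ∣ owners V ∣
  surplus-─ {V} x (V⊆U , surplus) unbalanced =
    (V⊆U ∘ p─q⊆p V (𝒮 x) , ≤-<-trans owners′≤ fewer-than-points) , fewer-owners
    where
    open ≤-Reasoning
    o : Subset n
    o = owners V
    owners′≤ : ∣ owners (V ─ 𝒮 x) ∣ ≤ ∣ o ─ below x ∣
    owners′≤ = p⊆q⇒∣p∣≤∣q∣ (owners-─ V x)
    fewer-owners : ∣ owners (V ─ 𝒮 x) ∣ < ∣ o ∣
    fewer-owners = begin-strict
      ∣ owners (V ─ 𝒮 x) ∣                ≤⟨ owners′≤ ⟩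
      ∣ o ─ below x ∣                     <⟨ m<n+m ∣ o ─ below x ∣ (≤-<-trans z≤n unbalanced) ⟩
      ∣ o ∩ below x ∣ + ∣ o ─ below x ∣   ≡⟨ sym (∣p∣≡∣p∩q∣+∣p─q∣ o (below x)) ⟩
      ∣ o ∣                               ∎
    fewer-than-points : ∣ o ─ below x ∣ < ∣ V ─ 𝒮 x ∣
    fewer-than-points = +-cancelˡ-< ∣ o ∩ below x ∣ _ _ (begin-strict
      ∣ o ∩ below x ∣ + ∣ o ─ below x ∣   ≡⟨ sym (∣p∣≡∣p∩q∣+∣p─q∣ o (below x)) ⟩
      ∣ o ∣                               <⟨ surplus ⟩
      ∣ V ∣                               ≡⟨ ∣p∣≡∣p∩q∣+∣p─q∣ V (𝒮 x) ⟩
      ∣ V ∩ 𝒮 x ∣ + ∣ V ─ 𝒮 x ∣           ≡⟨ cong (λ p → ∣ p ∣ + ∣ V ─ 𝒮 x ∣) (∩-comm V (𝒮 x)) ⟩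
      ∣ 𝒮 x ∩ V ∣ + ∣ V ─ 𝒮 x ∣           <⟨ +-monoˡ-< ∣ V ─ 𝒮 x ∣ unbalanced ⟩
      ∣ o ∩ below x ∣ + ∣ V ─ 𝒮 x ∣       ∎)

  balance′ : ∀ V → Acc _<_ ∣ owners V ∣ → Surplus V → ∃[ W ] Surplus W × Balanced W
  balance′ V (acc rec) surplus with any? (λ x → ∣ 𝒮 x ∩ V ∣ <? ∣ owners V ∩ below x ∣)
  ... | yes (x , unbalanced) =
    let surplus′ , fewer = surplus-─ x surplus unbalanced
    in balance′ (V ─ 𝒮 x) (rec fewer) surplus′
  ... | no balanced = V , surplus , λ x → ≮⇒≥ λ unbalanced → balanced (x , unbalanced)

  balance : ∀ V → Surplus V → ∃[ W ] Surplus W × Balanced W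
  balance V = balance′ V (<-wellFounded _)

  surplus-U : n < ∣ U ∣ → Surplus U
  surplus-U large = ⊆-refl , ≤-<-trans (∣p∣≤n (owners U)) large

smaller-ground⇒strict-reduction : ∀ {P} {R′ R : InclRep P} →
  groundSize R′ < groundSize R → (∀ x → ∣ S R′ x ∣ ≤ ∣ S R x ∣) → IsStrictReduction R′ R
smaller-ground⇒strict-reduction smaller sizes =
  (<⇒≤ smaller , sizes) , λ (_ , larger , _) → <⇒≱ smaller larger

module _ {P : FinPoset} (R : InclRep P) where
  open Compression (S R)

  squeezed : Subset (m R) → InclRep P
  squeezed V = record
    { m          = size P + m R
    ; S          = squeeze V
    ; represents = λ x y → let to , from = represents R x y
                           in squeeze-mono V ∘ to , from ∘ squeeze-reflects V
    }

  large⇒reducible : size P < groundSize R → ∃[ R′ ] IsStrictReduction R′ R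
  large⇒reducible large =
    let V , surplus , balanced = balance U (surplus-U large)
    in squeezed V , smaller-ground⇒strict-reduction {R′ = squeezed V} {R}
                      (squeeze-ground surplus) (squeeze-size balanced)

theorem1p3 : (P : FinPoset) → 0 < size P →
    (R : InclRep P) → Irreducible R → groundSize R ≤ size P
theorem1p3 P _ R irreducible =
  ≮⇒≥ λ large → let R′ , strict = large⇒reducible R large in irreducible R′ strict
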